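{- Let $p\ne 3$ be a prime, let $q=p^k$, and let $G=\mathrm{PSL}(2,q)$ be considered in its transitive action (by left multiplication) on the left cosets of a subgroup isomorphic to $\mathbb{Z}_3$. Then a non-canonical basic intersecting set in $G$ contains no point stabilizer as a proper subset.
   Context: For $G\le\mathrm{Sym}(V)$, a subset $\mathcal{F}\subseteq G$ is intersecting if for any $g,h\in\mathcal{F}$ there is $v\in V$ with $g(v)=h(v)$. An intersecting set is basic if it contains the identity. A canonical intersecting set is a coset $gG_v$ of a point stabilizer $G_v$ ($g\in G$, $v\in V$); a non-canonical intersecting set is one that is not of this form. -}

module Defs where

open import Data.Nat using (ℕ)
open import Data.Fin using (Fin)
open import Data.Product using (∃; _×_; _,_)
open import Data.Sum using (_⊎_)
open import Relation.Nullary using (¬_)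
open import Relation.Binary.PropositionalEquality using (_≡_; _≢_)
open import Algebra.Core using (Op₁; Op₂)
open import Algebra.Structures using (IsCommutativeRing)
open import Function.Bundles using (_↔_)

record FiniteField : Set₁ where
  field
    F     : Set
    _+_   : Op₂ F
    _*_   : Op₂ F
    -_    : Op₁ F
    0#    : F
    1#    : F
    isCommutativeRing : IsCommutativeRing _≡_ _+_ _*_ -_ 0# 1#
    0≢1   : 0# ≢ 1#
    inverse : ∀ x → x ≢ 0# → ∃ λ y → (x * y) ≡ 1#
    size  : ℕ
    enum  : Fin size ↔ F

-- Elements of G are represented by 2×2 matrices of determinant 1
-- (elements of SL(2,F)); two such representatives denote the same element
-- of PSL(2,F) iff they are equal up to the sign ±1 (relation _≈_).
-- Subsets of G are predicates on matrices that only hold for determinant-1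
-- matrices and respect _≈_.
module PSL2 (𝔽 : FiniteField) where
  open FiniteField 𝔽

  record Mat : Set where
    constructor mat
    field
      a b c d : F
  open Mat

  det : Mat → F
  det m = (a m * d m) + (- (b m * c m))

  InSL : Mat → Set
  InSL m = det m ≡ 1#

  infixl 7 _·_
  _·_ : Mat → Mat → Mat
  g · h = mat ((a g * a h) + (b g * c h)) ((a g * b h) + (b g * d h))
              ((c g * a h) + (d g * c h)) ((c g * b h) + (d g * d h))

  I : Mat
  I = mat 1# 0# 0# 1#

  neg : Mat → Mat
  neg m = mat (- a m) (- b m) (- c m) (- d m)

  -- inverse of a determinant-1 matrix (the adjugate)
  inv : Mat → Mat
  inv m = mat (d m) (- b m) (- c m) (a m)

  infix 4 _≈_
  _≈_ : Mat → Mat → Set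
  g ≈ h = (g ≡ h) ⊎ (g ≡ neg h)

  OrderThree : Mat → Set
  OrderThree α = InSL α × ¬ (α ≈ I) × (α · α · α ≈ I)

  record IsSubsetOfG (S : Mat → Set) : Set where
    field
      inSL     : ∀ g → S g → InSL g
      respects : ∀ g h → g ≈ h → S g → S h

  module Action (α : Mat) where
    InH : Mat → Set
    InH y = (y ≈ I) ⊎ (y ≈ α) ⊎ (y ≈ α · α)

    -- xH = yH  (points of V = G/H are represented by x ∈ G)
    SameCoset : Mat → Mat → Set
    SameCoset x y = InH (inv x · y)

    Agree : Mat → Mat → Mat → Set
    Agree g h x = SameCoset (g · x) (h · x)

    Intersecting : (Mat → Set) → Set
    Intersecting S = ∀ g h → S g → S h → ∃ λ x → InSL x × Agree g h x

    Basic : (Mat → Set) → Set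
    Basic S = S I

    Stab : Mat → Mat → Set
    Stab x g = InSL g × SameCoset (g · x) x

    Coset : Mat → Mat → Mat → Set
    Coset g x y = ∃ λ s → Stab x s × (y ≈ g · s)

    Canonical : (Mat → Set) → Set
    Canonical S = ∃ λ g → ∃ λ x → InSL g × InSL x ×
                    (∀ y → (S y → Coset g x y) × (Coset g x y → S y))

    ProperSubset : (Mat → Set) → (Mat → Set) → Set
    ProperSubset P Q = (∀ y → P y → Q y) × ∃ λ y → Q y × ¬ P y

-- Suppose an intersecting set S properly contains the stabiliser G_{xH} = x H x⁻¹ and take g ∈ S outside
-- it. For h ∈ H = {1, α, α²}, g and s_h = x h⁻¹ x⁻¹ ∈ G_{xH} ⊆ S agree on some point yH, i.e.
-- (gy)⁻¹ s_h y ∈ H; it is not ±1 because g ∉ G_{xH}, so it is ±α or ±α², whose traces square to 1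
-- (an element of order 3 in PSL(2,q) has trace ±1). By conjugation invariance T(h) = tr(g⁻¹ s_h)
-- satisfies T(h)² = 1, while Cayley–Hamilton for α⁻¹ gives T(α²) = tr(α) T(α) − T(1). Such signs exist
-- only if 3 = 0, which is impossible in characteristic p ≠ 3.
module Submission where

open import Defs

open import Algebra.Bundles using (Semiring; CommutativeRing)
open import Algebra.Solver.Ring.AlmostCommutativeRing
  using (fromCommutativeRing; _-Raw-AlmostCommutative⟶_)
open import Data.Fin using (Fin; combine)
open import Data.Fin.Patterns using (0F; 1F; 2F; 3F)
open import Data.Fin.Permutation using (Permutation′; permutation)
open import Data.Fin.Properties using (inj⇒≟)
open import Data.Integer as ℤ using (ℤ; +_; -[1+_]; _⊖_; _◃_; sign; ∣_∣)
import Data.Integer.Properties as ℤ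
open import Data.Maybe using (Maybe; just; nothing)
open import Data.Nat as ℕ using (ℕ; zero; suc; _^_)
open import Data.Nat.Coprimality as Coprime using (Coprime; coprime-Bézout; prime⇒coprime)
open import Data.Nat.GCD using (module Bézout)
open import Data.Nat.Primality using (Prime; prime?; prime⇒nonZero)
import Data.Nat.Properties as ℕ
open import Data.Product using (_,_; proj₁; proj₂)
open import Data.Sign as Sign using (Sign)
open import Data.Sum using (_⊎_; inj₁; inj₂)
open import Data.Vec as Vec using (Vec; []; _∷_; concat)
open import Data.Vec.N-ary using (N-ary; _$ⁿ_; curryⁿ; Eq; curryⁿ-cong)
open import Function.Bundles using (Inverse)
open import Function.Properties.Inverse using (↔⇒↣; ↔-sym)
open import Relation.Binary.Definitions using (DecidableEquality; tri<; tri≈; tri>)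
open import Relation.Binary.PropositionalEquality as ≡ using (_≡_; _≢_)
open import Relation.Nullary using (¬_; yes; no; contradiction)
open import Relation.Nullary.Decidable using (toWitness)

-- Algebra.Solver.Ring needs coefficients whose equality computes; ℤ maps into every commutative ring.
-- The optimised _×_ makes fromℤ (+ 1) definitionally 1#, so solved identities mention 1# rather than 1# + 0#.
module IntegerCoefficients {c ℓ} (R : CommutativeRing c ℓ) where
  open CommutativeRing R
  open import Algebra.Properties.Ring ring using (-‿distribˡ-*; -‿involutive; -0#≈0#; -‿+-comm)
  open import Algebra.Properties.Semiring.Mult.TCOptimised semiring
    using (_×_; 1+×; ×-homo-+; ×1-homo-*)
  open import Algebra.Properties.CommutativeSemigroup +-commutativeSemigroup using (interchange)
  open import Algebra.Properties.CommutativeSemigroup *-commutativeSemigroup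
    using () renaming (interchange to *-interchange)
  open import Relation.Binary.Reasoning.Setoid setoid

  fromℤ : ℤ → Carrier
  fromℤ (+ n)    = n × 1#
  fromℤ -[1+ n ] = - (suc n × 1#)

  fromℤ-⊖ : ∀ m n → fromℤ (m ⊖ n) ≈ m × 1# + - (n × 1#)
  fromℤ-⊖ m zero = begin
    fromℤ (m ⊖ 0)    ≡⟨ ≡.cong fromℤ (ℤ.⊖-≥ {m} ℕ.z≤n) ⟩
    m × 1#           ≈⟨ +-identityʳ _ ⟨
    m × 1# + 0#      ≈⟨ +-congˡ -0#≈0# ⟨
    m × 1# + - 0#    ∎
  fromℤ-⊖ zero (suc n) = sym (+-identityˡ _)
  fromℤ-⊖ (suc m) (suc n) = begin
    fromℤ (suc m ⊖ suc n)            ≡⟨ ≡.cong fromℤ (ℤ.[1+m]⊖[1+n]≡m⊖n m n) ⟩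
    fromℤ (m ⊖ n)                    ≈⟨ fromℤ-⊖ m n ⟩
    m × 1# + - (n × 1#)              ≈⟨ +-identityˡ _ ⟨
    0# + (m × 1# + - (n × 1#))       ≈⟨ +-congʳ (-‿inverseʳ 1#) ⟨
    (1# + - 1#) + (m × 1# + - (n × 1#)) ≈⟨ interchange 1# (- 1#) (m × 1#) (- (n × 1#)) ⟩
    (1# + m × 1#) + (- 1# + - (n × 1#)) ≈⟨ +-congˡ (-‿+-comm 1# (n × 1#)) ⟩
    (1# + m × 1#) + - (1# + n × 1#)  ≈⟨ +-cong (1+× m 1#) (-‿cong (1+× n 1#)) ⟨
    suc m × 1# + - (suc n × 1#)      ∎

  fromℤ-+ : ∀ i j → fromℤ (i ℤ.+ j) ≈ fromℤ i + fromℤ j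
  fromℤ-+ -[1+ m ] -[1+ n ] = begin
    - (suc (suc (m ℕ.+ n)) × 1#)         ≡⟨ ≡.cong (λ k → - (suc k × 1#)) (ℕ.+-suc m n) ⟨
    - ((suc m ℕ.+ suc n) × 1#)           ≈⟨ -‿cong (×-homo-+ 1# (suc m) (suc n)) ⟩
    - (suc m × 1# + suc n × 1#)          ≈⟨ -‿+-comm _ _ ⟨
    - (suc m × 1#) + - (suc n × 1#)      ∎
  fromℤ-+ -[1+ m ] (+ n)    = trans (fromℤ-⊖ n (suc m)) (+-comm _ _)
  fromℤ-+ (+ m)    -[1+ n ] = fromℤ-⊖ m (suc n)
  fromℤ-+ (+ m)    (+ n)    = ×-homo-+ 1# m n

  fromℤ-neg : ∀ i → fromℤ (ℤ.- i) ≈ - fromℤ i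
  fromℤ-neg -[1+ n ]    = sym (-‿involutive _)
  fromℤ-neg (+ zero)    = sym -0#≈0#
  fromℤ-neg (+ (suc n)) = refl

  fromSign : Sign → Carrier
  fromSign Sign.+ = 1#
  fromSign Sign.- = - 1#

  fromSign-* : ∀ s t → fromSign (s Sign.* t) ≈ fromSign s * fromSign t
  fromSign-* Sign.+ t      = sym (*-identityˡ _)
  fromSign-* Sign.- Sign.+ = sym (*-identityʳ _)
  fromSign-* Sign.- Sign.- = begin
    1#              ≈⟨ -‿involutive 1# ⟨
    - - 1#          ≈⟨ -‿cong (*-identityˡ (- 1#)) ⟨
    - (1# * - 1#)   ≈⟨ -‿distribˡ-* 1# (- 1#) ⟩
    - 1# * - 1#     ∎

  fromℤ-◃ : ∀ s n → fromℤ (s ◃ n) ≈ fromSign s * (n × 1#)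
  fromℤ-◃ s      zero    = sym (zeroʳ _)
  fromℤ-◃ Sign.+ (suc n) = sym (*-identityˡ _)
  fromℤ-◃ Sign.- (suc n) = trans (-‿cong (sym (*-identityˡ _))) (-‿distribˡ-* _ _)

  fromℤ-* : ∀ i j → fromℤ (i ℤ.* j) ≈ fromℤ i * fromℤ j
  fromℤ-* i j = begin
    fromℤ (i ℤ.* j)
      ≈⟨ fromℤ-◃ (sign i Sign.* sign j) (∣ i ∣ ℕ.* ∣ j ∣) ⟩
    fromSign (sign i Sign.* sign j) * ((∣ i ∣ ℕ.* ∣ j ∣) × 1#)
      ≈⟨ *-cong (fromSign-* (sign i) (sign j)) (×1-homo-* ∣ i ∣ ∣ j ∣) ⟩
    (fromSign (sign i) * fromSign (sign j)) * (∣ i ∣ × 1# * ∣ j ∣ × 1#)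
      ≈⟨ *-interchange _ _ _ _ ⟩
    (fromSign (sign i) * ∣ i ∣ × 1#) * (fromSign (sign j) * ∣ j ∣ × 1#)
      ≈⟨ *-cong (signAbs i) (signAbs j) ⟨
    fromℤ i * fromℤ j ∎
    where
    signAbs : ∀ k → fromℤ k ≈ fromSign (sign k) * (∣ k ∣ × 1#)
    signAbs k = trans (reflexive (≡.cong fromℤ (≡.sym (ℤ.◃-inverse k)))) (fromℤ-◃ (sign k) ∣ k ∣)

  homomorphism : ℤ.+-*-rawRing -Raw-AlmostCommutative⟶ fromCommutativeRing R
  homomorphism = record
    { ⟦_⟧    = fromℤ
    ; +-homo = fromℤ-+
    ; *-homo = fromℤ-*
    ; -‿homo = fromℤ-neg
    ; 0-homo = refl
    ; 1-homo = refl
    }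

  coefficient? : ∀ i j → Maybe (fromℤ i ≈ fromℤ j)
  coefficient? i j with i ℤ.≟ j
  ... | yes ≡.refl = just refl
  ... | no _       = nothing

  open import Algebra.Solver.Ring ℤ.+-*-rawRing (fromCommutativeRing R) homomorphism coefficient? public

module _ {c ℓ} (R : CommutativeRing c ℓ) where
  open CommutativeRing R
  open IntegerCoefficients R using (Polynomial; solve; _:=_; con; _:+_; _:*_; :-_)
  open import Algebra.Properties.Semiring.Mult.TCOptimised semiring using (_×_)
  open import Relation.Binary.Reasoning.Setoid setoid

  -- With u = 2tAB, expanding (tB − A)² = 1 gives u = 1, while u² = 4t²A²B² = 4.
  squares≈1⇒3≈0 : ∀ {t A B} → t * t ≈ 1# → A * A ≈ 1# → B * B ≈ 1# →
                  (t * B + - A) * (t * B + - A) ≈ 1# → 3 × 1# ≈ 0#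
  squares≈1⇒3≈0 {t} {A} {B} t²≈1 A²≈1 B²≈1 C²≈1 = begin
    3 × 1#                                          ≈⟨ solve 0 (con (+ 3) := TWO :* TWO :* ONE :+ :- ONE) refl ⟩
    two * two * 1# + - 1#                           ≈⟨ +-congʳ (*-congˡ t²A²B²≈1) ⟨
    two * two * (t * t * (A * A) * (B * B)) + - 1#  ≈⟨ +-congʳ u²≈4t²A²B² ⟨
    u * u + - 1#                                    ≈⟨ +-congʳ (*-cong u≈1 u≈1) ⟩
    1# * 1# + - 1#                                  ≈⟨ solve 0 (ONE :* ONE :+ :- ONE := con (+ 0)) refl ⟩
    0#                                              ∎
    where
    ONE TWO : ∀ {n} → Polynomial n
    ONE = con (+ 1)
    TWO = ONE :+ ONE

    two u : Carrier
    two = 1# + 1#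
    u = two * (t * (A * B))

    t²A²B²≈1 : t * t * (A * A) * (B * B) ≈ 1#
    t²A²B²≈1 = begin
      t * t * (A * A) * (B * B)   ≈⟨ *-cong (*-cong t²≈1 A²≈1) B²≈1 ⟩
      1# * 1# * 1#                ≈⟨ solve 0 (ONE :* ONE :* ONE := ONE) refl ⟩
      1#                          ∎

    u²≈4t²A²B² : u * u ≈ two * two * (t * t * (A * A) * (B * B))
    u²≈4t²A²B² = solve 3 (λ t A B → (TWO :* (t :* (A :* B))) :* (TWO :* (t :* (A :* B)))
                                  := TWO :* TWO :* (t :* t :* (A :* A) :* (B :* B))) refl t A B

    u≈1 : u ≈ 1#
    u≈1 = begin
      u                                                    ≈⟨ expand-C² ⟩
      t * t * (B * B) + A * A + - ((t * B + - A) * (t * B + - A))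
                                                           ≈⟨ +-cong (+-cong (*-cong t²≈1 B²≈1) A²≈1) (-‿cong C²≈1) ⟩
      1# * 1# + 1# + - 1#                                  ≈⟨ solve 0 (ONE :* ONE :+ ONE :+ :- ONE := ONE) refl ⟩
      1#                                                   ∎
      where
      expand-C² : u ≈ t * t * (B * B) + A * A + - ((t * B + - A) * (t * B + - A))
      expand-C² = solve 3 (λ t A B → TWO :* (t :* (A :* B))
                                   := t :* t :* (B :* B) :+ A :* A :+ :- ((t :* B :+ :- A) :* (t :* B :+ :- A)))
                          refl t A B

module _ {c ℓ} (R : Semiring c ℓ) where
  open Semiring R
  open import Algebra.Properties.Semiring.Mult.TCOptimised R using (_×_; ×-homo-+; ×1-homo-*)
  open import Relation.Binary.Reasoning.Setoid setoid

  ×1≈0⇒multiple×1≈0 : ∀ k {m} → m × 1# ≈ 0# → (k ℕ.* m) × 1# ≈ 0#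
  ×1≈0⇒multiple×1≈0 k {m} m≈0 = begin
    (k ℕ.* m) × 1#       ≈⟨ ×1-homo-* k m ⟩
    k × 1# * m × 1#      ≈⟨ *-congˡ m≈0 ⟩
    k × 1# * 0#          ≈⟨ zeroʳ _ ⟩
    0#                   ∎

  coprime-×1≈0⇒1≈0 : ∀ {m n} → Coprime m n → m × 1# ≈ 0# → n × 1# ≈ 0# → 1# ≈ 0#
  coprime-×1≈0⇒1≈0 {m} {n} m⊥n m≈0 n≈0 = bézout (coprime-Bézout m⊥n)
    where
    1+a≡b⇒1≈0 : ∀ {a b} → 1 ℕ.+ a ≡ b → a × 1# ≈ 0# → b × 1# ≈ 0# → 1# ≈ 0#
    1+a≡b⇒1≈0 {a} {b} 1+a≡b a≈0 b≈0 = begin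
      1#                   ≈⟨ +-identityʳ 1# ⟨
      1# + 0#              ≈⟨ +-congˡ a≈0 ⟨
      1# + a × 1#          ≈⟨ ×-homo-+ 1# 1 a ⟨
      (1 ℕ.+ a) × 1#       ≡⟨ ≡.cong (_× 1#) 1+a≡b ⟩
      b × 1#               ≈⟨ b≈0 ⟩
      0#                   ∎
    bézout : Bézout.Identity 1 m n → 1# ≈ 0#
    bézout (Bézout.+- x y 1+yn≡xm) =
      1+a≡b⇒1≈0 1+yn≡xm (×1≈0⇒multiple×1≈0 y n≈0) (×1≈0⇒multiple×1≈0 x m≈0)
    bézout (Bézout.-+ x y 1+xm≡yn) =
      1+a≡b⇒1≈0 1+xm≡yn (×1≈0⇒multiple×1≈0 x m≈0) (×1≈0⇒multiple×1≈0 y n≈0)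

prime≢prime⇒coprime : ∀ {p q} → Prime p → Prime q → p ≢ q → Coprime p q
prime≢prime⇒coprime {p} {q} pp pq p≢q with ℕ.<-cmp p q
... | tri< p<q _ _ = Coprime.sym (prime⇒coprime pq {{prime⇒nonZero pp}} p<q)
... | tri≈ _ p≡q _ = contradiction p≡q p≢q
... | tri> _ _ q<p = prime⇒coprime pp {{prime⇒nonZero pq}} q<p

prime[3] : Prime 3
prime[3] = toWitness {a? = prime? 3} _

module FiniteFieldProperties (𝔽 : FiniteField) where
  open FiniteField 𝔽 using (F; isCommutativeRing; 0≢1; inverse; size; enum)

  commutativeRing : CommutativeRing _ _
  commutativeRing = record { isCommutativeRing = isCommutativeRing }

  open CommutativeRing commutativeRing
  open import Algebra.Properties.Semiring.Mult.TCOptimised semiring using (_×_; ×ᵤ≈×; ×1-homo-*)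
  open import Algebra.Properties.CommutativeMonoid.Sum +-commutativeMonoid
    using (sum; sum-permute; ∑-distrib-+; sum-replicate; sum-cong-≗)
  open import Algebra.Properties.AbelianGroup +-abelianGroup using (∙-cancelʳ)
  open ≡.≡-Reasoning

  infix 4 _≟_
  _≟_ : DecidableEquality F
  _≟_ = inj⇒≟ (↔⇒↣ (↔-sym enum))

  x*y≡0⇒x≡0⊎y≡0 : ∀ x y → x * y ≡ 0# → x ≡ 0# ⊎ y ≡ 0#
  x*y≡0⇒x≡0⊎y≡0 x y xy≡0 with x ≟ 0#
  ... | yes x≡0 = inj₁ x≡0
  ... | no x≢0 with inverse x x≢0
  ... | x⁻¹ , xx⁻¹≡1 = inj₂ (begin
    y               ≡⟨ *-identityˡ y ⟨
    1# * y          ≡⟨ ≡.cong (_* y) (≡.trans (≡.sym xx⁻¹≡1) (*-comm x x⁻¹)) ⟩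
    (x⁻¹ * x) * y   ≡⟨ *-assoc x⁻¹ x y ⟩
    x⁻¹ * (x * y)   ≡⟨ ≡.cong (x⁻¹ *_) xy≡0 ⟩
    x⁻¹ * 0#        ≡⟨ zeroʳ x⁻¹ ⟩
    0#              ∎)

  x≢0∧x*y≡0⇒y≡0 : ∀ {x y} → x ≢ 0# → x * y ≡ 0# → y ≡ 0#
  x≢0∧x*y≡0⇒y≡0 {x} {y} x≢0 xy≡0 with x*y≡0⇒x≡0⊎y≡0 x y xy≡0
  ... | inj₁ x≡0 = contradiction x≡0 x≢0
  ... | inj₂ y≡0 = y≡0

  -- Translation by 1# permutes the field, so the sum of all elements equals itself plus size × 1#.
  size×1≡0 : size × 1# ≡ 0#
  size×1≡0 = ∙-cancelʳ (sum element) (size × 1#) 0# (begin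
    size × 1# + sum element              ≡⟨ +-comm _ _ ⟩
    sum element + size × 1#              ≡⟨ +-congˡ (≡.trans (sum-replicate size) (×ᵤ≈× size 1#)) ⟨
    sum element + sum {size} (λ _ → 1#)  ≡⟨ ∑-distrib-+ element (λ _ → 1#) ⟨
    sum (λ i → element i + 1#)           ≡⟨ sum-cong-≗ (λ i → strictlyInverseˡ (element i + 1#)) ⟨
    sum (λ i → element (shift i))        ≡⟨ sum-permute element translation ⟨
    sum element                          ≡⟨ +-identityˡ _ ⟨
    0# + sum element                     ∎)
    where
    open Inverse enum renaming (to to element; from to index)
    shift unshift : Fin size → Fin size
    shift i = index (element i + 1#)
    unshift i = index (element i + - 1#)
    translation : Permutation′ size
    translation = permutation shift unshift
      (λ i → ≡.trans (≡.cong (λ x → index (x + 1#)) (strictlyInverseˡ _)) (cancel (-‿inverseˡ 1#) i))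
      (λ i → ≡.trans (≡.cong (λ x → index (x + - 1#)) (strictlyInverseˡ _)) (cancel (-‿inverseʳ 1#) i))
      where
      cancel : ∀ {u v} → u + v ≡ 0# → ∀ i → index ((element i + u) + v) ≡ i
      cancel {u} {v} u+v≡0 i = begin
        index ((element i + u) + v)   ≡⟨ ≡.cong index (+-assoc (element i) u v) ⟩
        index (element i + (u + v))   ≡⟨ ≡.cong (λ w → index (element i + w)) u+v≡0 ⟩
        index (element i + 0#)        ≡⟨ ≡.cong index (+-identityʳ (element i)) ⟩
        index (element i)             ≡⟨ strictlyInverseʳ i ⟩
        i                             ∎

  ^×1≡0⇒×1≡0 : ∀ p k → (p ℕ.^ k) × 1# ≡ 0# → p × 1# ≡ 0#
  ^×1≡0⇒×1≡0 p zero    1≡0 = contradiction (≡.sym 1≡0) 0≢1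
  ^×1≡0⇒×1≡0 p (suc k) pᵏ⁺¹≡0
    with x*y≡0⇒x≡0⊎y≡0 (p × 1#) ((p ℕ.^ k) × 1#)
                        (≡.trans (≡.sym (×1-homo-* p (p ℕ.^ k))) pᵏ⁺¹≡0)
  ... | inj₁ p≡0  = p≡0
  ... | inj₂ pᵏ≡0 = ^×1≡0⇒×1≡0 p k pᵏ≡0

  3×1≢0 : ∀ {p} k → Prime p → p ≢ 3 → size ≡ p ℕ.^ k → 3 × 1# ≢ 0#
  3×1≢0 {p} k pp p≢3 size≡pᵏ 3≡0 =
    0≢1 (≡.sym (coprime-×1≈0⇒1≈0 semiring (prime≢prime⇒coprime pp prime[3] p≢3) p≡0 3≡0))
    where
    p≡0 : p × 1# ≡ 0#
    p≡0 = ^×1≡0⇒×1≡0 p k (≡.subst (λ n → n × 1# ≡ 0#) size≡pᵏ size×1≡0)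

module SymbolicMatrices (𝔽 : FiniteField) where
  open import Data.Product using (_×_)
  open FiniteField 𝔽 using (F)
  open FiniteFieldProperties 𝔽 using (commutativeRing)
  open PSL2 𝔽 using (Mat; mat)
  open Mat
  open IntegerCoefficients commutativeRing public
    using (Polynomial; con; var; _:+_; _:*_; :-_; ⟦_⟧; prove; normalise; ⟦_⟧N)

  record Matrix (A : Set) : Set where
    constructor matrix
    field
      e₁₁ e₁₂ e₂₁ e₂₂ : A

  mapᴹ : ∀ {A B} → (A → B) → Matrix A → Matrix B
  mapᴹ f (matrix x y z w) = matrix (f x) (f y) (f z) (f w)

  module _ {n : ℕ} where
    open Matrix

    infixl 7 _·ᴾ_

    _·ᴾ_ : Matrix (Polynomial n) → Matrix (Polynomial n) → Matrix (Polynomial n)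
    g ·ᴾ h = matrix ((e₁₁ g :* e₁₁ h) :+ (e₁₂ g :* e₂₁ h))
                    ((e₁₁ g :* e₁₂ h) :+ (e₁₂ g :* e₂₂ h))
                    ((e₂₁ g :* e₁₁ h) :+ (e₂₂ g :* e₂₁ h))
                    ((e₂₁ g :* e₁₂ h) :+ (e₂₂ g :* e₂₂ h))

    Iᴾ : Matrix (Polynomial n)
    Iᴾ = matrix (con (+ 1)) (con (+ 0)) (con (+ 0)) (con (+ 1))

    negᴾ invᴾ : Matrix (Polynomial n) → Matrix (Polynomial n)
    negᴾ = mapᴹ :-_
    invᴾ (matrix x y z w) = matrix w (:- y) (:- z) x

    scalarᴾ : Polynomial n → Matrix (Polynomial n)
    scalarᴾ p = matrix p (con (+ 0)) (con (+ 0)) p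

    detᴾ trᴾ : Matrix (Polynomial n) → Polynomial n
    detᴾ (matrix x y z w) = (x :* w) :+ (:- (y :* z))
    trᴾ (matrix x y z w) = x :+ w

    ⟦_⟧ᴹ : Matrix (Polynomial n) → Vec F n → Mat
    ⟦ matrix x y z w ⟧ᴹ ρ = mat (⟦ x ⟧ ρ) (⟦ y ⟧ ρ) (⟦ z ⟧ ρ) (⟦ w ⟧ ρ)

  mat-cong : ∀ {x y z w x′ y′ z′ w′} → x ≡ x′ → y ≡ y′ → z ≡ z′ → w ≡ w′ →
             mat x y z w ≡ mat x′ y′ z′ w′
  mat-cong ≡.refl ≡.refl ≡.refl ≡.refl = ≡.refl

  variables : ∀ k → Vec (Matrix (Polynomial (k ℕ.* 4))) k
  variables k = Vec.tabulate λ i →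
    matrix (var (combine i 0F)) (var (combine i 1F)) (var (combine i 2F)) (var (combine i 3F))

  entries : ∀ {k} → Vec Mat k → Vec F (k ℕ.* 4)
  entries ms = concat (Vec.map (λ m → a m ∷ b m ∷ c m ∷ d m ∷ []) ms)

  module _ (k : ℕ) where
    Matᴾ : Set
    Matᴾ = Matrix (Polynomial (k ℕ.* 4))

    close : ∀ {B : Set} → N-ary k Matᴾ B → B
    close f = f $ⁿ variables k

  -- An identity between matrices in k variables holds as soon as its four entries, polynomials in 4k
  -- variables, have equal normal forms; matrix-solve k (λ G H … → lhs , rhs) refl : ∀ g h … → lhs ≡ rhs.
  polynomial-identity : ∀ {k} (ms : Vec Mat k) p q → normalise p ≡ normalise q →
                        ⟦ p ⟧ (entries ms) ≡ ⟦ q ⟧ (entries ms)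
  polynomial-identity ms p q p≡q = prove (entries ms) p q (≡.cong (λ N → ⟦ N ⟧N (entries ms)) p≡q)

  scalar-solve : ∀ k (f : N-ary k (Matᴾ k) (Polynomial (k ℕ.* 4) × Polynomial (k ℕ.* 4))) →
                 let (p , q) = close k f in normalise p ≡ normalise q →
                 Eq k _≡_ (curryⁿ λ ms → ⟦ p ⟧ (entries ms)) (curryⁿ λ ms → ⟦ q ⟧ (entries ms))
  scalar-solve k f p≡q = curryⁿ-cong _≡_ {n = k} _ _ λ ms → polynomial-identity ms p q p≡q
    where
    p q : Polynomial (k ℕ.* 4)
    p = proj₁ (close k f)
    q = proj₂ (close k f)

  matrix-solve : ∀ k (f : N-ary k (Matᴾ k) (Matᴾ k × Matᴾ k)) → let (P , Q) = close k f in
                 mapᴹ normalise P ≡ mapᴹ normalise Q →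
                 Eq k _≡_ (curryⁿ λ ms → ⟦ P ⟧ᴹ (entries ms)) (curryⁿ λ ms → ⟦ Q ⟧ᴹ (entries ms))
  matrix-solve k f P≡Q = curryⁿ-cong _≡_ {n = k} _ _ λ ms →
    mat-cong (polynomial-identity ms (e₁₁ P) (e₁₁ Q) (≡.cong e₁₁ P≡Q))
             (polynomial-identity ms (e₁₂ P) (e₁₂ Q) (≡.cong e₁₂ P≡Q))
             (polynomial-identity ms (e₂₁ P) (e₂₁ Q) (≡.cong e₂₁ P≡Q))
             (polynomial-identity ms (e₂₂ P) (e₂₂ Q) (≡.cong e₂₂ P≡Q))
    where
    open Matrix
    P Q : Matᴾ k
    P = proj₁ (close k f)
    Q = proj₂ (close k f)

module SL₂ (𝔽 : FiniteField) where
  open import Data.Product using (_×_)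
  open FiniteField 𝔽 using (F)
  open FiniteFieldProperties 𝔽 using (commutativeRing; _≟_; x*y≡0⇒x≡0⊎y≡0; x≢0∧x*y≡0⇒y≡0)
  open CommutativeRing commutativeRing hiding (_≈_)
  open PSL2 𝔽
  open Mat
  open SymbolicMatrices 𝔽
  open Matrix using (e₁₁; e₁₂; e₂₁; e₂₂)
  open IntegerCoefficients commutativeRing using (solve; _:=_)
  open import Algebra.Properties.Ring ring using (-0#≈0#)
  open import Algebra.Properties.AbelianGroup +-abelianGroup using (x∙y⁻¹≈ε⇒x≈y; inverseˡ-unique)
  open ≡.≡-Reasoning

  tr : Mat → F
  tr g = a g + d g

  scalar : F → Mat
  scalar x = mat x 0# 0# x

  ·-assoc : ∀ g h k → (g · h) · k ≡ g · (h · k)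
  ·-assoc = matrix-solve 3 (λ G H K → (G ·ᴾ H) ·ᴾ K , G ·ᴾ (H ·ᴾ K)) ≡.refl

  ·-identityˡ : ∀ g → I · g ≡ g
  ·-identityˡ = matrix-solve 1 (λ G → Iᴾ ·ᴾ G , G) ≡.refl

  ·-identityʳ : ∀ g → g · I ≡ g
  ·-identityʳ = matrix-solve 1 (λ G → G ·ᴾ Iᴾ , G) ≡.refl

  ·-inv-scalar : ∀ g → g · inv g ≡ scalar (det g)
  ·-inv-scalar = matrix-solve 1 (λ G → G ·ᴾ invᴾ G , scalarᴾ (detᴾ G)) ≡.refl

  inv-·-scalar : ∀ g → inv g · g ≡ scalar (det g)
  inv-·-scalar = matrix-solve 1 (λ G → invᴾ G ·ᴾ G , scalarᴾ (detᴾ G)) ≡.refl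

  inv-anti-homo-· : ∀ g h → inv (g · h) ≡ inv h · inv g
  inv-anti-homo-· = matrix-solve 2 (λ G H → invᴾ (G ·ᴾ H) , invᴾ H ·ᴾ invᴾ G) ≡.refl

  inv-involutive : ∀ g → inv (inv g) ≡ g
  inv-involutive = matrix-solve 1 (λ G → invᴾ (invᴾ G) , G) ≡.refl

  neg-involutive : ∀ g → neg (neg g) ≡ g
  neg-involutive = matrix-solve 1 (λ G → negᴾ (negᴾ G) , G) ≡.refl

  neg-·ˡ : ∀ g h → neg g · h ≡ neg (g · h)
  neg-·ˡ = matrix-solve 2 (λ G H → negᴾ G ·ᴾ H , negᴾ (G ·ᴾ H)) ≡.refl

  neg-·ʳ : ∀ g h → g · neg h ≡ neg (g · h)
  neg-·ʳ = matrix-solve 2 (λ G H → G ·ᴾ negᴾ H , negᴾ (G ·ᴾ H)) ≡.refl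

  det-· : ∀ g h → det (g · h) ≡ det g * det h
  det-· = scalar-solve 2 (λ G H → detᴾ (G ·ᴾ H) , detᴾ G :* detᴾ H) ≡.refl

  det-inv : ∀ g → det (inv g) ≡ det g
  det-inv = scalar-solve 1 (λ G → detᴾ (invᴾ G) , detᴾ G) ≡.refl

  det-neg : ∀ g → det (neg g) ≡ det g
  det-neg = scalar-solve 1 (λ G → detᴾ (negᴾ G) , detᴾ G) ≡.refl

  tr-neg : ∀ g → tr (neg g) ≡ - tr g
  tr-neg = scalar-solve 1 (λ G → trᴾ (negᴾ G) , :- trᴾ G) ≡.refl

  tr-comm : ∀ g h → tr (g · h) ≡ tr (h · g)
  tr-comm = scalar-solve 2 (λ G H → trᴾ (G ·ᴾ H) , trᴾ (H ·ᴾ G)) ≡.refl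

  det-I : det I ≡ 1#
  det-I = scalar-solve 0 (detᴾ Iᴾ , con (+ 1)) ≡.refl

  ·-inverseʳ : ∀ {g} → InSL g → g · inv g ≡ I
  ·-inverseʳ {g} g∈SL = ≡.trans (·-inv-scalar g) (≡.cong scalar g∈SL)

  ·-inverseˡ : ∀ {g} → InSL g → inv g · g ≡ I
  ·-inverseˡ {g} g∈SL = ≡.trans (inv-·-scalar g) (≡.cong scalar g∈SL)

  InSL-· : ∀ {g h} → InSL g → InSL h → InSL (g · h)
  InSL-· {g} {h} g∈SL h∈SL = begin
    det (g · h)        ≡⟨ det-· g h ⟩
    det g * det h      ≡⟨ ≡.cong₂ _*_ g∈SL h∈SL ⟩
    1# * 1#            ≡⟨ *-identityˡ 1# ⟩
    1#                 ∎

  InSL-inv : ∀ {g} → InSL g → InSL (inv g)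
  InSL-inv {g} g∈SL = ≡.trans (det-inv g) g∈SL

  ·-cancelʳ : ∀ {g h y} → InSL y → g · y ≡ h · y → g ≡ h
  ·-cancelʳ {g} {h} {y} y∈SL gy≡hy = begin
    g                  ≡⟨ ·-identityʳ g ⟨
    g · I              ≡⟨ ≡.cong (g ·_) (·-inverseʳ y∈SL) ⟨
    g · (y · inv y)    ≡⟨ ·-assoc g y (inv y) ⟨
    (g · y) · inv y    ≡⟨ ≡.cong (_· inv y) gy≡hy ⟩
    (h · y) · inv y    ≡⟨ ·-assoc h y (inv y) ⟩
    h · (y · inv y)    ≡⟨ ≡.cong (h ·_) (·-inverseʳ y∈SL) ⟩
    h · I              ≡⟨ ·-identityʳ h ⟩
    h                  ∎

  inv-·≡⇒≡· : ∀ {g h k} → InSL g → inv g · h ≡ k → h ≡ g · k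
  inv-·≡⇒≡· {g} {h} {k} g∈SL g⁻¹h≡k = begin
    h                  ≡⟨ ·-identityˡ h ⟨
    I · h              ≡⟨ ≡.cong (_· h) (·-inverseʳ g∈SL) ⟨
    (g · inv g) · h    ≡⟨ ·-assoc g (inv g) h ⟩
    g · (inv g · h)    ≡⟨ ≡.cong (g ·_) g⁻¹h≡k ⟩
    g · k              ∎

  tr-conjugate : ∀ {y} m → InSL y → tr (inv y · (m · y)) ≡ tr m
  tr-conjugate {y} m y∈SL = begin
    tr (inv y · (m · y))   ≡⟨ tr-comm (inv y) (m · y) ⟩
    tr ((m · y) · inv y)   ≡⟨ ≡.cong tr (·-assoc m y (inv y)) ⟩
    tr (m · (y · inv y))   ≡⟨ ≡.cong (λ z → tr (m · z)) (·-inverseʳ y∈SL) ⟩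
    tr (m · I)             ≡⟨ ≡.cong tr (·-identityʳ m) ⟩
    tr m                   ∎

  ≈-neg : ∀ {g h} → g ≈ h → neg g ≈ h
  ≈-neg         (inj₁ g≡h)  = inj₂ (≡.cong neg g≡h)
  ≈-neg {h = h} (inj₂ g≡-h) = inj₁ (≡.trans (≡.cong neg g≡-h) (neg-involutive h))

  tr²-resp-≈ : ∀ {g h} → g ≈ h → tr g * tr g ≡ tr h * tr h
  tr²-resp-≈ (inj₁ ≡.refl) = ≡.refl
  tr²-resp-≈ {h = h} (inj₂ ≡.refl) = begin
    tr (neg h) * tr (neg h)   ≡⟨ ≡.cong (λ t → t * t) (tr-neg h) ⟩
    - tr h * - tr h           ≡⟨ solve 1 (λ t → :- t :* :- t := t :* t) ≡.refl (tr h) ⟩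
    tr h * tr h               ∎

  IsScalar : Mat → Set
  IsScalar g = b g ≡ 0# × c g ≡ 0# × a g ≡ d g

  ≈I⇒IsScalar : ∀ {g} → g ≈ I → IsScalar g
  ≈I⇒IsScalar (inj₁ ≡.refl) = ≡.refl , ≡.refl , ≡.refl
  ≈I⇒IsScalar (inj₂ ≡.refl) = -0#≈0# , -0#≈0# , ≡.refl

  IsScalar∧InSL⇒≈I : ∀ {g} → IsScalar g → InSL g → g ≈ I
  IsScalar∧InSL⇒≈I {g} (b≡0 , c≡0 , a≡d) g∈SL
    with x*y≡0⇒x≡0⊎y≡0 (a g + - 1#) (a g + 1#) [a-1][a+1]≡0
    where
    a²≡1 : a g * a g ≡ 1#
    a²≡1 = begin
      a g * a g                      ≡⟨ ≡.cong (a g *_) a≡d ⟩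
      a g * d g                      ≡⟨ +-identityʳ _ ⟨
      a g * d g + 0#                 ≡⟨ +-congˡ (≡.trans (≡.cong -_ bc≡0) -0#≈0#) ⟨
      a g * d g + - (b g * c g)      ≡⟨ g∈SL ⟩
      1#                             ∎
      where
      bc≡0 : b g * c g ≡ 0#
      bc≡0 = ≡.trans (≡.cong (_* c g) b≡0) (zeroˡ (c g))
    [a-1][a+1]≡0 : (a g + - 1#) * (a g + 1#) ≡ 0#
    [a-1][a+1]≡0 = begin
      (a g + - 1#) * (a g + 1#)      ≡⟨ solve 1 (λ x → (x :+ :- con (+ 1)) :* (x :+ con (+ 1))
                                                     := x :* x :+ :- con (+ 1)) ≡.refl (a g) ⟩
      a g * a g + - 1#               ≡⟨ ≡.cong (λ z → a g * a g + - z) a²≡1 ⟨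
      a g * a g + - (a g * a g)      ≡⟨ -‿inverseʳ (a g * a g) ⟩
      0#                             ∎
  ... | inj₁ a-1≡0 = inj₁ (mat-cong a≡1 b≡0 c≡0 (≡.trans (≡.sym a≡d) a≡1))
    where
    a≡1 : a g ≡ 1#
    a≡1 = x∙y⁻¹≈ε⇒x≈y (a g) 1# a-1≡0
  ... | inj₂ a+1≡0 = inj₂ (mat-cong a≡-1 (≡.trans b≡0 (≡.sym -0#≈0#)) (≡.trans c≡0 (≡.sym -0#≈0#))
                                    (≡.trans (≡.sym a≡d) a≡-1))
    where
    a≡-1 : a g ≡ - 1#
    a≡-1 = inverseˡ-unique (a g) 1# a+1≡0

  -- Cayley–Hamilton: g · g · g = (tr g ² − det g) g − tr g · det g · I.
  cube-b : ∀ g → b (g · g · g) ≡ (tr g * tr g + - det g) * b g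
  cube-b = scalar-solve 1 (λ G → e₁₂ (G ·ᴾ G ·ᴾ G)
                               , (trᴾ G :* trᴾ G :+ :- detᴾ G) :* e₁₂ G) ≡.refl

  cube-c : ∀ g → c (g · g · g) ≡ (tr g * tr g + - det g) * c g
  cube-c = scalar-solve 1 (λ G → e₂₁ (G ·ᴾ G ·ᴾ G)
                               , (trᴾ G :* trᴾ G :+ :- detᴾ G) :* e₂₁ G) ≡.refl

  cube-a-d : ∀ g → a (g · g · g) + - d (g · g · g) ≡ (tr g * tr g + - det g) * (a g + - d g)
  cube-a-d = scalar-solve 1 (λ G → e₁₁ (G ·ᴾ G ·ᴾ G) :+ :- e₂₂ (G ·ᴾ G ·ᴾ G)
                                  , (trᴾ G :* trᴾ G :+ :- detᴾ G) :* (e₁₁ G :+ :- e₂₂ G)) ≡.refl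

  cube≈I⇒IsScalar : ∀ {g} → g · g · g ≈ I → tr g * tr g + - det g ≢ 0# → IsScalar g
  cube≈I⇒IsScalar {g} g³≈I t²-det≢0 = descend (≈I⇒IsScalar g³≈I)
    where
    cancel : ∀ {y} → (tr g * tr g + - det g) * y ≡ 0# → y ≡ 0#
    cancel = x≢0∧x*y≡0⇒y≡0 t²-det≢0
    descend : IsScalar (g · g · g) → IsScalar g
    descend (b³≡0 , c³≡0 , a³≡d³) =
        cancel (≡.trans (≡.sym (cube-b g)) b³≡0)
      , cancel (≡.trans (≡.sym (cube-c g)) c³≡0)
      , x∙y⁻¹≈ε⇒x≈y (a g) (d g) (cancel (begin
          (tr g * tr g + - det g) * (a g + - d g)   ≡⟨ cube-a-d g ⟨
          a (g · g · g) + - d (g · g · g)           ≡⟨ ≡.cong (_+ - d (g · g · g)) a³≡d³ ⟩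
          d (g · g · g) + - d (g · g · g)           ≡⟨ -‿inverseʳ _ ⟩
          0#                                        ∎))

  order-three⇒tr²≡1 : ∀ {α} → OrderThree α → tr α * tr α ≡ 1#
  order-three⇒tr²≡1 {α} (α∈SL , α≉I , α³≈I) with tr α * tr α + - det α ≟ 0#
  ... | yes t²-det≡0 = ≡.trans (x∙y⁻¹≈ε⇒x≈y _ _ t²-det≡0) α∈SL
  ... | no  t²-det≢0 =
    contradiction (IsScalar∧InSL⇒≈I (cube≈I⇒IsScalar α³≈I t²-det≢0) α∈SL) α≉I

  tr-sq : ∀ g → tr (g · g) ≡ tr g * tr g + - (det g + det g)
  tr-sq = scalar-solve 1 (λ G → trᴾ (G ·ᴾ G) , trᴾ G :* trᴾ G :+ :- (detᴾ G :+ detᴾ G)) ≡.refl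

  -- Cayley–Hamilton for h⁻¹, conjugated by x and paired with m under the trace form.
  tr-recurrence : ∀ m x h → tr (m · (x · inv (h · h) · inv x))
                          ≡ tr h * tr (m · (x · inv h · inv x)) + - (det h * tr (m · (x · inv I · inv x)))
  tr-recurrence = scalar-solve 3 (λ M X H →
      trᴾ (M ·ᴾ (X ·ᴾ invᴾ (H ·ᴾ H) ·ᴾ invᴾ X))
    , trᴾ H :* trᴾ (M ·ᴾ (X ·ᴾ invᴾ H ·ᴾ invᴾ X))
      :+ :- (detᴾ H :* trᴾ (M ·ᴾ (X ·ᴾ invᴾ Iᴾ ·ᴾ invᴾ X)))) ≡.refl

module CosetAction (𝔽 : FiniteField) (α : PSL2.Mat 𝔽) (α-order-three : PSL2.OrderThree 𝔽 α) where
  open FiniteFieldProperties 𝔽 using (commutativeRing)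
  open CommutativeRing commutativeRing hiding (_≈_)
  open PSL2 𝔽
  open SL₂ 𝔽
  open Action α
  open IntegerCoefficients commutativeRing using (Polynomial; solve; _:=_; con; _:+_; _:*_; :-_)
  open import Algebra.Properties.Semiring.Mult.TCOptimised semiring using (_×_)
  open ≡.≡-Reasoning

  α∈SL : InSL α
  α∈SL = proj₁ α-order-three

  tr²α≡1 : tr α * tr α ≡ 1#
  tr²α≡1 = order-three⇒tr²≡1 α-order-three

  tr²α²≡1 : tr (α · α) * tr (α · α) ≡ 1#
  tr²α²≡1 = begin
    tr (α · α) * tr (α · α)              ≡⟨ ≡.cong (λ t → t * t) tr[α²]≡-1 ⟩
    - 1# * - 1#                          ≡⟨ solve 0 (:- ONE :* :- ONE := ONE) ≡.refl ⟩
    1#                                   ∎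
    where
    ONE : Polynomial 0
    ONE = con (+ 1)
    tr[α²]≡-1 : tr (α · α) ≡ - 1#
    tr[α²]≡-1 = begin
      tr (α · α)                         ≡⟨ tr-sq α ⟩
      tr α * tr α + - (det α + det α)    ≡⟨ ≡.cong₂ (λ t² δ → t² + - (δ + δ)) tr²α≡1 α∈SL ⟩
      1# + - (1# + 1#)                   ≡⟨ solve 0 (ONE :+ :- (ONE :+ ONE) := :- ONE) ≡.refl ⟩
      - 1#                               ∎

  InH-neg : ∀ {h} → InH h → InH (neg h)
  InH-neg (inj₁ h≈I)         = inj₁ (≈-neg h≈I)
  InH-neg (inj₂ (inj₁ h≈α))  = inj₂ (inj₁ (≈-neg h≈α))
  InH-neg (inj₂ (inj₂ h≈α²)) = inj₂ (inj₂ (≈-neg h≈α²))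

  InH-tr²≡1 : ∀ {h} → InH h → ¬ h ≈ I → tr h * tr h ≡ 1#
  InH-tr²≡1 (inj₁ h≈I)         h≉I = contradiction h≈I h≉I
  InH-tr²≡1 (inj₂ (inj₁ h≈α))  _   = ≡.trans (tr²-resp-≈ h≈α) tr²α≡1
  InH-tr²≡1 (inj₂ (inj₂ h≈α²)) _   = ≡.trans (tr²-resp-≈ h≈α²) tr²α²≡1

  module _ (x : Mat) (x∈SL : InSL x) where

    stabiliserElement : Mat → Mat
    stabiliserElement h = x · inv h · inv x

    stabiliserElement∈Stab : ∀ {h} → InSL h → InH h → Stab x (stabiliserElement h)
    stabiliserElement∈Stab {h} h∈SL h∈H =
      InSL-· (InSL-· x∈SL (InSL-inv h∈SL)) (InSL-inv x∈SL) , ≡.subst InH (≡.sym returns-h) h∈H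
      where
      cancel-x : ∀ g → (g · inv x) · x ≡ g
      cancel-x g = begin
        (g · inv x) · x   ≡⟨ ·-assoc g (inv x) x ⟩
        g · (inv x · x)   ≡⟨ ≡.cong (g ·_) (·-inverseˡ x∈SL) ⟩
        g · I             ≡⟨ ·-identityʳ g ⟩
        g                 ∎
      returns-h : inv (stabiliserElement h · x) · x ≡ h
      returns-h = begin
        inv (stabiliserElement h · x) · x     ≡⟨ ≡.cong (λ g → inv g · x) (cancel-x (x · inv h)) ⟩
        inv (x · inv h) · x                   ≡⟨ ≡.cong (_· x) (inv-anti-homo-· x (inv h)) ⟩
        (inv (inv h) · inv x) · x             ≡⟨ cancel-x (inv (inv h)) ⟩
        inv (inv h)                           ≡⟨ inv-involutive h ⟩
        h                                     ∎

    Stab-resp-≈ : ∀ {g s} → Stab x s → g ≈ s → Stab x g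
    Stab-resp-≈ s∈Stab (inj₁ ≡.refl) = s∈Stab
    Stab-resp-≈ {s = s} (s∈SL , s∈H) (inj₂ ≡.refl) =
      ≡.trans (det-neg s) s∈SL , ≡.subst InH (≡.sym neg-commutes) (InH-neg s∈H)
      where
      neg-commutes : inv (neg s · x) · x ≡ neg (inv (s · x) · x)
      neg-commutes = ≡.trans (≡.cong (λ g → inv g · x) (neg-·ˡ s x)) (neg-·ˡ (inv (s · x)) x)

    agreement≈I⇒≈ : ∀ {g s y} → InSL g → InSL y → inv (g · y) · (s · y) ≈ I → g ≈ s
    agreement≈I⇒≈ {g} {s} {y} g∈SL y∈SL (inj₁ agr≡I) =
      inj₁ (≡.sym (·-cancelʳ y∈SL (≡.trans (inv-·≡⇒≡· gy∈SL agr≡I) (·-identityʳ (g · y)))))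
      where
      gy∈SL : InSL (g · y)
      gy∈SL = InSL-· g∈SL y∈SL
    agreement≈I⇒≈ {g} {s} {y} g∈SL y∈SL (inj₂ agr≡-I) =
      inj₂ (≡.trans (≡.sym (neg-involutive g)) (≡.cong neg (≡.sym (·-cancelʳ y∈SL sy≡-gy))))
      where
      sy≡-gy : s · y ≡ neg g · y
      sy≡-gy = begin
        s · y                 ≡⟨ inv-·≡⇒≡· (InSL-· g∈SL y∈SL) agr≡-I ⟩
        (g · y) · neg I       ≡⟨ neg-·ʳ (g · y) I ⟩
        neg ((g · y) · I)     ≡⟨ ≡.cong neg (·-identityʳ (g · y)) ⟩
        neg (g · y)           ≡⟨ neg-·ˡ g y ⟨
        neg g · y             ∎

    tr-agreement : ∀ {g s y} → InSL y → tr (inv (g · y) · (s · y)) ≡ tr (inv g · s)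
    tr-agreement {g} {s} {y} y∈SL = begin
      tr (inv (g · y) · (s · y))          ≡⟨ ≡.cong (λ m → tr (m · (s · y))) (inv-anti-homo-· g y) ⟩
      tr ((inv y · inv g) · (s · y))      ≡⟨ ≡.cong tr (·-assoc (inv y) (inv g) (s · y)) ⟩
      tr (inv y · (inv g · (s · y)))      ≡⟨ ≡.cong (λ m → tr (inv y · m)) (·-assoc (inv g) s y) ⟨
      tr (inv y · ((inv g · s) · y))      ≡⟨ tr-conjugate (inv g · s) y∈SL ⟩
      tr (inv g · s)                      ∎

    -- The agreement element (gy)⁻¹(sy) lies in H, and it is not ±I since otherwise g = ±s would fix x H.
    outside-Stab-tr²≡1 : ∀ {g s y} → InSL g → ¬ Stab x g → Stab x s → InSL y → Agree g s y →
                         tr (inv g · s) * tr (inv g · s) ≡ 1#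
    outside-Stab-tr²≡1 {g} {s} {y} g∈SL g∉Stab s∈Stab y∈SL agree = begin
      tr (inv g · s) * tr (inv g · s)                           ≡⟨ ≡.cong (λ t → t * t) (tr-agreement y∈SL) ⟨
      tr (inv (g · y) · (s · y)) * tr (inv (g · y) · (s · y))   ≡⟨ InH-tr²≡1 agree agreement≉I ⟩
      1#                                                        ∎
      where
      agreement≉I : ¬ inv (g · y) · (s · y) ≈ I
      agreement≉I agr≈I = g∉Stab (Stab-resp-≈ s∈Stab (agreement≈I⇒≈ g∈SL y∈SL agr≈I))

    Intersecting⇒¬Stab⊂ : 3 × 1# ≢ 0# → ∀ {S} → IsSubsetOfG S → Intersecting S →
                          ¬ ProperSubset (Stab x) S
    Intersecting⇒¬Stab⊂ 3≢0 {S} S⊆G S-intersecting (Stab⊆S , g , g∈S , g∉Stab) =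
      3≢0 (squares≈1⇒3≈0 commutativeRing tr²α≡1 (T²≡1 det-I I∈H) (T²≡1 α∈SL α∈H)
             (≡.subst (λ t → t * t ≡ 1#) recurrence (T²≡1 (InSL-· α∈SL α∈SL) α²∈H)))
      where
      g∈SL : InSL g
      g∈SL = IsSubsetOfG.inSL S⊆G g g∈S
      I∈H : InH I
      I∈H  = inj₁ (inj₁ ≡.refl)
      α∈H : InH α
      α∈H  = inj₂ (inj₁ (inj₁ ≡.refl))
      α²∈H : InH (α · α)
      α²∈H = inj₂ (inj₂ (inj₁ ≡.refl))

      T : Mat → Carrier
      T h = tr (inv g · stabiliserElement h)

      T²≡1 : ∀ {h} → InSL h → InH h → T h * T h ≡ 1#
      T²≡1 {h} h∈SL h∈H =
        let y , y∈SL , agree = S-intersecting g (stabiliserElement h) g∈S (Stab⊆S _ s∈Stab)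
        in  outside-Stab-tr²≡1 g∈SL g∉Stab s∈Stab y∈SL agree
        where
        s∈Stab : Stab x (stabiliserElement h)
        s∈Stab = stabiliserElement∈Stab h∈SL h∈H

      recurrence : T (α · α) ≡ tr α * T α + - T I
      recurrence = begin
        T (α · α)                         ≡⟨ tr-recurrence (inv g) x α ⟩
        tr α * T α + - (det α * T I)      ≡⟨ ≡.cong (λ δ → tr α * T α + - (δ * T I)) α∈SL ⟩
        tr α * T α + - (1# * T I)         ≡⟨ ≡.cong (λ z → tr α * T α + - z) (*-identityˡ (T I)) ⟩
        tr α * T α + - T I                ∎

proposition2p13 : (𝔽 : FiniteField) (p k : ℕ) → Prime p → p ≢ 3 →
    FiniteField.size 𝔽 ≡ p ^ k →
    let open PSL2 𝔽 in
    (α : Mat) → OrderThree α →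
    let open Action α in
    (S : Mat → Set) → IsSubsetOfG S → Intersecting S → Basic S → ¬ Canonical S →
    (x : Mat) → InSL x → ¬ ProperSubset (Stab x) S
proposition2p13 𝔽 p k p-prime p≢3 size≡pᵏ α α-order-three S S⊆G S-intersecting _ _ x x∈SL =
  CosetAction.Intersecting⇒¬Stab⊂ 𝔽 α α-order-three x x∈SL
    (FiniteFieldProperties.3×1≢0 𝔽 k p-prime p≢3 size≡pᵏ) S⊆G S-intersecting
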